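{- Let $\ell,\ell_{out}$ be positive integers with $\ell\ge\ell_{out}$, let $m=2^{\ell_{out}}$ and let $n<m$. For an $\ell$-bit multiplier $a$ let $h^0_a(x) = (ax\bmod 2^\ell)/2^\ell$ and let $\mu_a$ be the minimal positive integer such that $\|h^0_a(\mu_a)\|\le 1/(2m)$. Fix $a$ and let $x\in\{1,\dots,n-1\}$ satisfy $\|h^0_a(x)\|\le 1/(2m)$. Then $x\neq\mu_a$ if and only if there is a prime factor $p$ of $x$ with $\|h^0_a(x/p)\|\le 1/(2pm)$.
   Context: For real $y$, $\|y\|=\min\{y\bmod 1, -y\bmod 1\}$, the distance from $0$ in the circular unit interval. -}

module Defs where

open import Data.Nat as ℕ using (ℕ; zero; suc; _^_; _*_; _%_; _<_)
open import Data.Nat.Properties using (m^n≢0)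
open import Data.Integer as ℤ using (ℤ; +_)
open import Data.Rational as ℚ using (ℚ; floor; _-_; -_; _⊓_; _/_; _≤_)
open import Data.Product using (_×_)
open import Relation.Nullary using (¬_)

mod1 : ℚ → ℚ
mod1 y = y - (floor y / 1)

‖_‖ : ℚ → ℚ
‖ y ‖ = mod1 y ⊓ mod1 (- y)

h⁰ : (ℓ a x : ℕ) → ℚ
h⁰ ℓ a x = (+ ((a * x) % (2 ^ ℓ))) / (2 ^ ℓ)
  where instance _ = m^n≢0 2 ℓ

-- 1/(2k) as a rational; only ever used with k > 0 (the value at k = 0 is irrelevant junk)
1/2× : ℕ → ℚ
1/2× zero    = ℚ.0ℚ
1/2× (suc k) = (+ 1) / (2 * suc k)

IsMinMu : (ℓ m a μ : ℕ) → Set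
IsMinMu ℓ m a μ =
  0 < μ × ‖ h⁰ ℓ a μ ‖ ≤ 1/2× m ×
  (∀ y → 0 < y → y < μ → ¬ (‖ h⁰ ℓ a y ‖ ≤ 1/2× m))

-- Say that y is K-near when some representative t of a·y modulo N = 2^ℓ has |t|·2K ≤ N; this
-- is ‖h⁰_a(y)‖ ≤ 1/(2K). If u and x are K-near with u + x < 2K, with representatives s and t,
-- then N divides u·t − x·s while |u·t − x·s| < N, so u·t = x·s. For u = μ < x this makes
-- t − ⌊x/μ⌋·s a representative of a·(x mod μ) no larger than s, so minimality of μ forces μ ∣ x,
-- say x = kμ with t = k·s and k ≥ 2. For a prime p ∣ k, k = jp, the cofactor q = jμ of p in x
-- has representative j·s, and |j·s|·2pK = |t|·2K ≤ N. Conversely, such a cofactor q < x is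
-- K-near, so x cannot be the least K-near number.
module Submission where

open import Defs
open import Data.Nat as ℕ using (ℕ; zero; suc; _^_; _*_; _∸_; _<_; _≤_; z≤n; s≤s; NonZero)
import Data.Nat.Properties as ℕ
import Data.Nat.DivMod as ℕ
import Data.Nat.Divisibility as ℕ
open import Data.Nat.Divisibility using (divides)
open import Data.Nat.ListAction using (product)
open import Data.Nat.Primality using (Prime; prime⇒nonZero; prime⇒nonTrivial)
open import Data.Nat.Primality.Factorisation using (factorise)
import Data.Nat.Tactic.RingSolver as ℕ-Solver
open import Data.Integer as ℤ using (ℤ; +_; -[1+_]; +≤+; +<+; ∣_∣; 0ℤ; -1ℤ)
import Data.Integer.Properties as ℤ
open import Data.Integer.Divisibility.Signed using (_∣_; divides; ∣-refl; ∣m∣n⇒∣m-n; ∣n⇒∣m*n)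
open import Data.Integer.Tactic.RingSolver using (solve)
open import Data.Rational as ℚ using (ℚ; mkℚ; _/_; floor; toℚᵘ; 0ℚ; 1ℚ; *≤*; *<*)
  renaming (_≤_ to _≤ℚ_; _<_ to _<ℚ_)
import Data.Rational.Properties as ℚ
open import Data.Rational.Unnormalised as ℚᵘ using (mkℚᵘ; _≃_)
import Data.Rational.Unnormalised.Properties as ℚᵘ
open import Data.List using (_∷_; [])
import Data.List.Relation.Unary.All as All
open import Data.Product using (∃-syntax; _×_; _,_; proj₁; proj₂)
open import Data.Sum as Sum using (_⊎_; inj₁; inj₂; [_,_]′)
open import Data.Sum.Function.Propositional using (_⊎-⇔_)
open import Function.Base using (_$_; _∘_)
open import Function.Bundles using (_⇔_; mk⇔; Equivalence)
open import Function.Construct.Composition using (_⇔-∘_)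
open import Function.Construct.Symmetry using (⇔-sym)
open import Relation.Binary.PropositionalEquality
  using (_≡_; _≢_; refl; sym; trans; cong; cong₂; subst; subst₂; module ≡-Reasoning)
open import Relation.Nullary using (¬_; contradiction)

toℚᵘ-/ : ∀ i n .{{_ : NonZero n}} → toℚᵘ (i / n) ≃ mkℚᵘ i (ℕ.pred n)
toℚᵘ-/ i (suc n) = ℚ.toℚᵘ-fromℚᵘ (mkℚᵘ i n)

/≤/⇔ : ∀ r s m n .{{_ : NonZero m}} .{{_ : NonZero n}} →
       (+ r / m ≤ℚ + s / n) ⇔ (r * n ≤ s * m)
/≤/⇔ r s m@(suc _) n@(suc _) = mk⇔
  (λ r/m≤s/n → cross⁻ (ℚᵘ.≤-respʳ-≃ (toℚᵘ-/ (+ s) n) (ℚᵘ.≤-respˡ-≃ (toℚᵘ-/ (+ r) m)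
                 (ℚ.toℚᵘ-mono-≤ r/m≤s/n))))
  (λ rn≤sm → ℚ.toℚᵘ-cancel-≤ (ℚᵘ.≤-respʳ-≃ (ℚᵘ.≃-sym (toℚᵘ-/ (+ s) n))
                 (ℚᵘ.≤-respˡ-≃ (ℚᵘ.≃-sym (toℚᵘ-/ (+ r) m)) (cross rn≤sm))))
  where
  cross : r * n ≤ s * m → mkℚᵘ (+ r) (ℕ.pred m) ℚᵘ.≤ mkℚᵘ (+ s) (ℕ.pred n)
  cross h = ℚᵘ.*≤* (subst₂ ℤ._≤_ (ℤ.pos-* r n) (ℤ.pos-* s m) (+≤+ h))
  cross⁻ : mkℚᵘ (+ r) (ℕ.pred m) ℚᵘ.≤ mkℚᵘ (+ s) (ℕ.pred n) → r * n ≤ s * m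
  cross⁻ (ℚᵘ.*≤* h) = ℤ.drop‿+≤+ (subst₂ ℤ._≤_ (sym (ℤ.pos-* r n)) (sym (ℤ.pos-* s m)) h)

/</ : ∀ r s m n .{{_ : NonZero m}} .{{_ : NonZero n}} → r * n < s * m → + r / m <ℚ + s / n
/</ r s m@(suc _) n@(suc _) rn<sm = ℚ.toℚᵘ-cancel-< (ℚᵘ.<-respʳ-≃ (ℚᵘ.≃-sym (toℚᵘ-/ (+ s) n))
  (ℚᵘ.<-respˡ-≃ (ℚᵘ.≃-sym (toℚᵘ-/ (+ r) m))
    (ℚᵘ.*<* (subst₂ ℤ._<_ (ℤ.pos-* r n) (ℤ.pos-* s m) (+<+ rn<sm)))))

floor≡0 : ∀ p → 0ℚ ≤ℚ p → p <ℚ 1ℚ → floor p ≡ 0ℤ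
floor≡0 (mkℚ (+ k) d-1 _) _ (*<* k<d)
  rewrite ℤ.*-identityʳ (+ k) | ℤ.*-identityˡ (+ suc d-1) with k<d
... | +<+ k<d rewrite ℕ.m<n⇒m/n≡0 k<d = refl
floor≡0 (mkℚ -[1+ k ] d-1 _) (*≤* ()) _

floor≡-1 : ∀ p → ℚ.- 1ℚ <ℚ p → p <ℚ 0ℚ → floor p ≡ -1ℤ
floor≡-1 (mkℚ (+ k) d-1 _) _ (*<* p<0) rewrite ℤ.*-identityʳ (+ k) with p<0
... | +<+ ()
floor≡-1 (mkℚ -[1+ k ] d-1 _) (*<* -1<p) _
  rewrite ℤ.-1*i≡-i (+ suc d-1) | ℤ.*-identityʳ -[1+ k ] with -1<p
... | ℤ.-<- k<d = cong (ℤ._*_ (+ 1)) (-[1+k]/ℕd≡-1 (s≤s k<d))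
  where
  -[1+k]/ℕd≡-1 : ∀ {k d} .{{_ : NonZero d}} → suc k < d → -[1+ k ] ℤ./ℕ d ≡ -1ℤ
  -[1+k]/ℕd≡-1 {k} {d} k<d with suc k ℕ.% d | ℕ.m<n⇒m%n≡m k<d
  ... | .(suc k) | refl = cong -[1+_] (ℕ.m<n⇒m/n≡0 k<d)

mod1-id : ∀ p → 0ℚ ≤ℚ p → p <ℚ 1ℚ → mod1 p ≡ p
mod1-id p 0≤p p<1 = trans (cong (λ z → p ℚ.- (z / 1)) (floor≡0 p 0≤p p<1)) (ℚ.+-identityʳ p)

mod1-neg : ∀ p → 0ℚ <ℚ p → p <ℚ 1ℚ → mod1 (ℚ.- p) ≡ ℚ.- p ℚ.+ 1ℚ
mod1-neg p 0<p p<1 =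
  cong (λ z → ℚ.- p ℚ.- (z / 1)) (floor≡-1 (ℚ.- p) (ℚ.neg-antimono-< p<1) (ℚ.neg-antimono-< 0<p))

-r/n+1≡[n∸r]/n : ∀ r n .{{_ : NonZero n}} → r ≤ n → ℚ.- (+ r / n) ℚ.+ 1ℚ ≡ + (n ∸ r) / n
-r/n+1≡[n∸r]/n r n@(suc _) r≤n = ℚ.toℚᵘ-injective (begin
  toℚᵘ (ℚ.- (+ r / n) ℚ.+ 1ℚ)           ≈⟨ ℚ.toℚᵘ-homo-+ (ℚ.- (+ r / n)) 1ℚ ⟩
  toℚᵘ (ℚ.- (+ r / n)) ℚᵘ.+ ℚᵘ.1ℚᵘ     ≈⟨ ℚᵘ.+-congˡ ℚᵘ.1ℚᵘ (ℚᵘ.≃-trans (ℚ.toℚᵘ-homo‿- (+ r / n))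
                                                                  (ℚᵘ.-‿cong (toℚᵘ-/ (+ r) n))) ⟩
  ℚᵘ.- mkℚᵘ (+ r) (ℕ.pred n) ℚᵘ.+ ℚᵘ.1ℚᵘ ≈⟨ ℚᵘ.*≡* cross-multiplied ⟩
  mkℚᵘ (+ (n ∸ r)) (ℕ.pred n)          ≈⟨ ℚᵘ.≃-sym (toℚᵘ-/ (+ (n ∸ r)) n) ⟩
  toℚᵘ (+ (n ∸ r) / n)                   ∎)
  where
  open ℚᵘ.≃-Reasoning
  s = n ∸ r
  n≡r+s : + n ≡ + r ℤ.+ + s
  n≡r+s = trans (cong +_ (sym (ℕ.m+[n∸m]≡n r≤n))) (ℤ.pos-+ r s)
  identity : ∀ R S →
             ((ℤ.- R) ℤ.* + 1 ℤ.+ + 1 ℤ.* (R ℤ.+ S)) ℤ.* (R ℤ.+ S) ≡ S ℤ.* ((R ℤ.+ S) ℤ.* + 1)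
  identity R S = solve (R ∷ S ∷ [])
  cross-multiplied : ((ℤ.- + r) ℤ.* + 1 ℤ.+ + 1 ℤ.* + n) ℤ.* + n ≡ + s ℤ.* + (n * 1)
  cross-multiplied = trans (subst (λ N → ((ℤ.- + r) ℤ.* + 1 ℤ.+ + 1 ℤ.* N) ℤ.* N ≡ + s ℤ.* (N ℤ.* + 1))
                       (sym n≡r+s) (identity (+ r) (+ s)))
                (cong (+ s ℤ.*_) (sym (ℤ.pos-* n 1)))

⊓≤⇔ : ∀ p q r → (p ℚ.⊓ q ≤ℚ r) ⇔ (p ≤ℚ r ⊎ q ≤ℚ r)
⊓≤⇔ p q r = mk⇔
  (λ p⊓q≤r → [ (λ p⊓q≡p → inj₁ (subst (_≤ℚ r) p⊓q≡p p⊓q≤r))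
             , (λ p⊓q≡q → inj₂ (subst (_≤ℚ r) p⊓q≡q p⊓q≤r))
             ]′ (ℚ.⊓-sel p q))
  [ ℚ.≤-trans (ℚ.p⊓q≤p p q) , ℚ.≤-trans (ℚ.p⊓q≤q p q) ]′

/≤1/2×⇔ : ∀ x n K .{{_ : NonZero n}} .{{_ : NonZero K}} →
          (+ x / n ≤ℚ 1/2× K) ⇔ (x * (2 * K) ≤ n)
/≤1/2×⇔ x n K@(suc _) =
  subst (λ m → (+ x / n ≤ℚ 1/2× K) ⇔ (x * (2 * K) ≤ m)) (ℕ.*-identityˡ n) (/≤/⇔ x 1 n (2 * K))

0≤r/n : ∀ r n .{{_ : NonZero n}} → 0ℚ ≤ℚ + r / n
0≤r/n r n = Equivalence.from (/≤/⇔ 0 r 1 n) z≤n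

r/n<1 : ∀ r n .{{_ : NonZero n}} → r < n → + r / n <ℚ 1ℚ
r/n<1 r n r<n = /</ r 1 n 1 (subst₂ _<_ (sym (ℕ.*-identityʳ r)) (sym (ℕ.*-identityˡ n)) r<n)

mod1[r/n]≤1/2×⇔ : ∀ r n K .{{_ : NonZero n}} .{{_ : NonZero K}} → r < n →
                  (mod1 (+ r / n) ≤ℚ 1/2× K) ⇔ (r * (2 * K) ≤ n)
mod1[r/n]≤1/2×⇔ r n K r<n
  rewrite mod1-id (+ r / n) (0≤r/n r n) (r/n<1 r n r<n) = /≤1/2×⇔ r n K

mod1[-r/n]≤1/2×⇔ : ∀ r n K .{{_ : NonZero n}} .{{_ : NonZero K}} → 0 < r → r < n →
                   (mod1 (ℚ.- (+ r / n)) ≤ℚ 1/2× K) ⇔ ((n ∸ r) * (2 * K) ≤ n)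
mod1[-r/n]≤1/2×⇔ r n K 0<r r<n
  rewrite mod1-neg (+ r / n) (/</ 0 r 1 n (subst (0 <_) (sym (ℕ.*-identityʳ r)) 0<r))
                   (r/n<1 r n r<n)
        | -r/n+1≡[n∸r]/n r n (ℕ.<⇒≤ r<n) = /≤1/2×⇔ (n ∸ r) n K

‖r/n‖≤1/2×⇔ : ∀ r n K .{{_ : NonZero n}} .{{_ : NonZero K}} → r < n →
              (‖ + r / n ‖ ≤ℚ 1/2× K) ⇔ (r * (2 * K) ≤ n ⊎ (n ∸ r) * (2 * K) ≤ n)
‖r/n‖≤1/2×⇔ zero n K 0<n = mk⇔ (λ _ → inj₁ z≤n)
  (λ _ → Equivalence.from (⊓≤⇔ _ _ _) (inj₁ (Equivalence.from (mod1[r/n]≤1/2×⇔ 0 n K 0<n) z≤n)))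
‖r/n‖≤1/2×⇔ r@(suc _) n K r<n =
  (mod1[r/n]≤1/2×⇔ r n K r<n ⊎-⇔ mod1[-r/n]≤1/2×⇔ r n K (s≤s z≤n) r<n) ⇔-∘ ⊓≤⇔ _ _ _

i≡i-j+j : ∀ i j → i ≡ (i ℤ.- j) ℤ.+ j
i≡i-j+j i j = solve (i ∷ j ∷ [])

m*n<n⇒m≡0 : ∀ {m n} → m * n < n → m ≡ 0
m*n<n⇒m≡0 {zero} _ = refl
m*n<n⇒m≡0 {suc m} {n} mn<n = contradiction mn<n (ℕ.≤⇒≯ (ℕ.m≤m+n n (m * n)))

∣∧∣i∣<∣n∣⇒i≡0 : ∀ {n i} → n ∣ i → ∣ i ∣ < ∣ n ∣ → i ≡ 0ℤ
∣∧∣i∣<∣n∣⇒i≡0 {n} (divides q refl) ∣qn∣<∣n∣ =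
  cong (ℤ._* n) (ℤ.∣i∣≡0⇒i≡0 {q} (m*n<n⇒m≡0 (subst (_< ∣ n ∣) (ℤ.abs-* q n) ∣qn∣<∣n∣)))

-[1+e]*n+r≡-[[1+e]*n∸r] : ∀ e n r → r ≤ suc e * n →
                          -[1+ e ] ℤ.* + n ℤ.+ + r ≡ ℤ.- + (suc e * n ∸ r)
-[1+e]*n+r≡-[[1+e]*n∸r] e n r r≤M = begin
  -[1+ e ] ℤ.* + n ℤ.+ + r      ≡⟨ cong (ℤ._+ + r) (ℤ.neg-distribˡ-* (+ suc e) (+ n)) ⟨
  ℤ.- (+ suc e ℤ.* + n) ℤ.+ + r ≡⟨ cong (λ i → ℤ.- i ℤ.+ + r) (ℤ.pos-* (suc e) n) ⟨
  ℤ.- + (suc e * n) ℤ.+ + r     ≡⟨ ℤ.-m+n≡n⊖m (suc e * n) r ⟩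
  r ℤ.⊖ suc e * n               ≡⟨ ℤ.⊖-≤ r≤M ⟩
  ℤ.- + (suc e * n ∸ r)         ∎
  where open ≡-Reasoning

∣-⇒r≤∣t∣⊎N∸r≤∣t∣ : ∀ {N r t} → + N ∣ t ℤ.- + r → r ≤ N → r ≤ ∣ t ∣ ⊎ N ∸ r ≤ ∣ t ∣
∣-⇒r≤∣t∣⊎N∸r≤∣t∣ {N} {r} {t} (divides q t-r≡qN) r≤N
  with q | trans (i≡i-j+j t (+ r)) (cong (ℤ._+ + r) t-r≡qN)
... | + e      | t≡eN+r = inj₁ (begin
  r                       ≤⟨ ℕ.m≤n+m r (e * N) ⟩
  e * N ℕ.+ r             ≡⟨ cong ∣_∣ (trans (cong (ℤ._+ + r) (sym (ℤ.pos-* e N)))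
                                             (sym (ℤ.pos-+ (e * N) r))) ⟨
  ∣ + e ℤ.* + N ℤ.+ + r ∣ ≡⟨ cong ∣_∣ t≡eN+r ⟨
  ∣ t ∣                   ∎)
  where open ℕ.≤-Reasoning
... | -[1+ e ] | t≡-[1+e]N+r = inj₂ (begin
  N ∸ r                       ≤⟨ ℕ.∸-monoˡ-≤ r (ℕ.m≤m+n N (e * N)) ⟩
  suc e * N ∸ r               ≡⟨ ℤ.∣-i∣≡∣i∣ (+ (suc e * N ∸ r)) ⟨
  ∣ ℤ.- + (suc e * N ∸ r) ∣   ≡⟨ cong ∣_∣ (trans t≡-[1+e]N+r
                                               (-[1+e]*n+r≡-[[1+e]*n∸r] e N r r≤M)) ⟨
  ∣ t ∣                       ∎)
  where
  open ℕ.≤-Reasoning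
  r≤M = ℕ.≤-trans r≤N (ℕ.m≤m+n N (e * N))

*-sub-collinear : ∀ u x t s k → u ℤ.* t ≡ x ℤ.* s →
                  u ℤ.* (t ℤ.- k ℤ.* s) ≡ (x ℤ.- k ℤ.* u) ℤ.* s
*-sub-collinear u x t s k ut≡xs = begin
  u ℤ.* (t ℤ.- k ℤ.* s)         ≡⟨ solve (u ∷ t ∷ s ∷ k ∷ []) ⟩
  u ℤ.* t ℤ.- k ℤ.* u ℤ.* s     ≡⟨ cong (ℤ._- k ℤ.* u ℤ.* s) ut≡xs ⟩
  x ℤ.* s ℤ.- k ℤ.* u ℤ.* s     ≡⟨ solve (x ∷ s ∷ k ∷ u ∷ []) ⟩
  (x ℤ.- k ℤ.* u) ℤ.* s         ∎
  where open ≡-Reasoning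

+x-+[x/u]*+u≡+[x%u] : ∀ x u .{{_ : NonZero u}} → + x ℤ.- + (x ℕ./ u) ℤ.* + u ≡ + (x ℕ.% u)
+x-+[x/u]*+u≡+[x%u] x u = begin
  + x ℤ.- + (x ℕ./ u) ℤ.* + u   ≡⟨ cong (ℤ._-_ (+ x)) (ℤ.pos-* (x ℕ./ u) u) ⟨
  + x ℤ.- + (x ℕ./ u * u)       ≡⟨ ℤ.[+m]-[+n]≡m⊖n x (x ℕ./ u * u) ⟩
  x ℤ.⊖ x ℕ./ u * u             ≡⟨ ℤ.⊖-≥ (ℕ.m/n*n≤m x u) ⟩
  + (x ∸ x ℕ./ u * u)           ≡⟨ cong +_ (ℕ.m%n≡m∸m/n*n x u) ⟨
  + (x ℕ.% u)                   ∎
  where open ≡-Reasoning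

∃-prime-divisor : ∀ {k} → 2 ≤ k → ∃[ p ] (Prime p × p ℕ.∣ k)
∃-prime-divisor {suc k} 2≤k with factorise (suc k)
... | record { factors = [] ; isFactorisation = k≡1 } = contradiction (sym k≡1) (ℕ.<⇒≢ 2≤k)
... | record { factors = p ∷ ps ; isFactorisation = k≡∏ ; factorsPrime = p-prime All.∷ _ } =
  p , p-prime , subst (p ℕ.∣_) (sym k≡∏) (ℕ.m∣m*n (product ps))

module _ (n a : ℤ) where

  record Represents (y t : ℤ) : Set where
    constructor represents
    field ∣t-ay : n ∣ t ℤ.- a ℤ.* y

  -- Near K y is the condition ‖a y / |n|‖ ≤ 1/(2K).
  Near : ℕ → ℕ → Set
  Near K y = ∃[ t ] (Represents (+ y) t × ∣ t ∣ * (2 * K) ≤ ∣ n ∣)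

  represents-sub : ∀ {y z t s} k → Represents y t → Represents z s →
                   Represents (y ℤ.- k ℤ.* z) (t ℤ.- k ℤ.* s)
  represents-sub {y} {z} {t} {s} k (represents n∣t-ay) (represents n∣s-az) =
    represents $ subst (n ∣_) identity (∣m∣n⇒∣m-n n∣t-ay (∣n⇒∣m*n k n∣s-az))
    where
    identity : t ℤ.- a ℤ.* y ℤ.- k ℤ.* (s ℤ.- a ℤ.* z) ≡
               t ℤ.- k ℤ.* s ℤ.- a ℤ.* (y ℤ.- k ℤ.* z)
    identity = solve (t ∷ s ∷ y ∷ z ∷ k ∷ a ∷ [])

  represents-* : ∀ {y t} k → Represents y t → Represents (k ℤ.* y) (k ℤ.* t)
  represents-* {y} {t} k (represents n∣t-ay) =
    represents $ subst (n ∣_) identity (∣n⇒∣m*n k n∣t-ay)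
    where
    identity : k ℤ.* (t ℤ.- a ℤ.* y) ≡ k ℤ.* t ℤ.- a ℤ.* (k ℤ.* y)
    identity = solve (k ∷ t ∷ y ∷ a ∷ [])

  represents-∣- : ∀ {y t s} → Represents y t → Represents y s → n ∣ t ℤ.- s
  represents-∣- {y} {t} {s} (represents n∣t-ay) (represents n∣s-ay) =
    subst (n ∣_) identity (∣m∣n⇒∣m-n n∣t-ay n∣s-ay)
    where
    identity : t ℤ.- a ℤ.* y ℤ.- (s ℤ.- a ℤ.* y) ≡ t ℤ.- s
    identity = solve (t ∷ s ∷ y ∷ a ∷ [])

  represents-cross : ∀ {y z t s} → Represents y t → Represents z s → n ∣ z ℤ.* t ℤ.- y ℤ.* s
  represents-cross {y} {z} {t} {s} (represents n∣t-ay) (represents n∣s-az) =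
    subst (n ∣_) identity (∣m∣n⇒∣m-n (∣n⇒∣m*n z n∣t-ay) (∣n⇒∣m*n y n∣s-az))
    where
    identity : z ℤ.* (t ℤ.- a ℤ.* y) ℤ.- y ℤ.* (s ℤ.- a ℤ.* z) ≡ z ℤ.* t ℤ.- y ℤ.* s
    identity = solve (z ∷ t ∷ y ∷ s ∷ a ∷ [])

  represents-a*y : ∀ y → Represents y (a ℤ.* y)
  represents-a*y y = represents (divides 0ℤ (ℤ.+-inverseʳ (a ℤ.* y)))

  represents-shift : ∀ {y t} k → Represents y t → Represents y (t ℤ.- k ℤ.* n)
  represents-shift {y} {t} k (represents n∣t-ay) =
    represents $ subst (n ∣_) identity (∣m∣n⇒∣m-n n∣t-ay (∣n⇒∣m*n k ∣-refl))
    where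
    identity : t ℤ.- a ℤ.* y ℤ.- k ℤ.* n ≡ t ℤ.- k ℤ.* n ℤ.- a ℤ.* y
    identity = solve (t ∷ k ∷ n ∷ a ∷ y ∷ [])

  near-antitone : ∀ {K L y} → K ≤ L → Near L y → Near K y
  near-antitone {K} {L} K≤L (t , rt , t≤) =
    t , rt , ℕ.≤-trans (ℕ.*-monoʳ-≤ ∣ t ∣ (ℕ.*-monoʳ-≤ 2 K≤L)) t≤

  -- Both n ∣ u t - x s and |u t - x s| < |n|, so the cross product vanishes.
  near-collinear : ∀ {K x u t s} .{{_ : ℤ.NonZero n}} → Represents (+ x) t → Represents (+ u) s →
                   ∣ t ∣ * (2 * K) ≤ ∣ n ∣ → ∣ s ∣ * (2 * K) ≤ ∣ n ∣ → u ℕ.+ x < 2 * K →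
                   + u ℤ.* t ≡ + x ℤ.* s
  near-collinear {K} {x} {u} {t} {s} rt rs t≤ s≤ u+x<2K =
    ℤ.i-j≡0⇒i≡j _ _ (∣∧∣i∣<∣n∣⇒i≡0 (represents-cross rt rs) (ℕ.*-cancelʳ-< (2 * K) _ _ bound))
    where
    open ℕ.≤-Reasoning
    bound : ∣ + u ℤ.* t ℤ.- + x ℤ.* s ∣ * (2 * K) < ∣ n ∣ * (2 * K)
    bound = begin-strict
      ∣ + u ℤ.* t ℤ.- + x ℤ.* s ∣ * (2 * K)
        ≤⟨ ℕ.*-monoˡ-≤ (2 * K) (subst₂ (λ i j → ∣ + u ℤ.* t ℤ.- + x ℤ.* s ∣ ≤ i ℕ.+ j)
                                       (ℤ.abs-* (+ u) t) (ℤ.abs-* (+ x) s)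
                                       (ℤ.∣i-j∣≤∣i∣+∣j∣ (+ u ℤ.* t) (+ x ℤ.* s))) ⟩
      (u * ∣ t ∣ ℕ.+ x * ∣ s ∣) * (2 * K)
        ≡⟨ ℕ.*-distribʳ-+ (2 * K) (u * ∣ t ∣) (x * ∣ s ∣) ⟩
      u * ∣ t ∣ * (2 * K) ℕ.+ x * ∣ s ∣ * (2 * K)
        ≡⟨ cong₂ ℕ._+_ (ℕ.*-assoc u ∣ t ∣ (2 * K)) (ℕ.*-assoc x ∣ s ∣ (2 * K)) ⟩
      u * (∣ t ∣ * (2 * K)) ℕ.+ x * (∣ s ∣ * (2 * K))
        ≤⟨ ℕ.+-mono-≤ (ℕ.*-monoʳ-≤ u t≤) (ℕ.*-monoʳ-≤ x s≤) ⟩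
      u * ∣ n ∣ ℕ.+ x * ∣ n ∣
        ≡⟨ ℕ.*-distribʳ-+ ∣ n ∣ u x ⟨
      (u ℕ.+ x) * ∣ n ∣
        <⟨ ℕ.*-monoˡ-< ∣ n ∣ u+x<2K ⟩
      2 * K * ∣ n ∣
        ≡⟨ ℕ.*-comm (2 * K) ∣ n ∣ ⟩
      ∣ n ∣ * (2 * K) ∎

  near-remainder : ∀ {K x u t s} .{{_ : NonZero u}} → Represents (+ x) t → Represents (+ u) s →
                   ∣ s ∣ * (2 * K) ≤ ∣ n ∣ → + u ℤ.* t ≡ + x ℤ.* s → Near K (x ℕ.% u)
  near-remainder {K} {x} {u} {t} {s} rt rs s≤ ut≡xs =
    t′ , subst (λ y → Represents y t′) (+x-+[x/u]*+u≡+[x%u] x u) (represents-sub (+ k) rt rs) ,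
    ℕ.≤-trans (ℕ.*-monoˡ-≤ (2 * K) ∣t′∣≤∣s∣) s≤
    where
    k = x ℕ./ u
    t′ = t ℤ.- + k ℤ.* s
    u*t′≡[x%u]*s : + u ℤ.* t′ ≡ + (x ℕ.% u) ℤ.* s
    u*t′≡[x%u]*s = trans (*-sub-collinear (+ u) (+ x) t s (+ k) ut≡xs)
                         (cong (ℤ._* s) (+x-+[x/u]*+u≡+[x%u] x u))
    ∣t′∣≤∣s∣ : ∣ t′ ∣ ≤ ∣ s ∣
    ∣t′∣≤∣s∣ = ℕ.*-cancelˡ-≤ u (begin
      u * ∣ t′ ∣             ≡⟨ ℤ.abs-* (+ u) t′ ⟨
      ∣ + u ℤ.* t′ ∣         ≡⟨ cong ∣_∣ u*t′≡[x%u]*s ⟩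
      ∣ + (x ℕ.% u) ℤ.* s ∣  ≡⟨ ℤ.abs-* (+ (x ℕ.% u)) s ⟩
      x ℕ.% u * ∣ s ∣        ≤⟨ ℕ.*-monoˡ-≤ ∣ s ∣ (ℕ.<⇒≤ (ℕ.m%n<n x u)) ⟩
      u * ∣ s ∣              ∎)
      where open ℕ.≤-Reasoning

  near-multiple-of-least : ∀ {K u x s t} .{{_ : ℤ.NonZero n}} .{{_ : NonZero u}} →
    (∀ y → 0 < y → y < u → ¬ Near K y) →
    Represents (+ u) s → ∣ s ∣ * (2 * K) ≤ ∣ n ∣ →
    Represents (+ x) t → ∣ t ∣ * (2 * K) ≤ ∣ n ∣ → u ℕ.+ x < 2 * K →
    x ≡ x ℕ./ u * u × t ≡ + (x ℕ./ u) ℤ.* s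
  near-multiple-of-least {K} {u} {x} {s} {t} least rs s≤ rt t≤ u+x<2K = x≡ku , t≡ks
    where
    k = x ℕ./ u
    ut≡xs : + u ℤ.* t ≡ + x ℤ.* s
    ut≡xs = near-collinear {K} rt rs t≤ s≤ u+x<2K
    x%u≡0 : x ℕ.% u ≡ 0
    x%u≡0 = ℕ.n≤0⇒n≡0 (ℕ.≮⇒≥ λ 0<x%u →
      least (x ℕ.% u) 0<x%u (ℕ.m%n<n x u) (near-remainder {K} rt rs s≤ ut≡xs))
    x≡ku : x ≡ k * u
    x≡ku = trans (ℕ.m≡m%n+[m/n]*n x u) (cong (ℕ._+ k * u) x%u≡0)
    t≡ks : t ≡ + k ℤ.* s
    t≡ks = ℤ.*-cancelˡ-≡ (+ u) t (+ k ℤ.* s) (begin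
      + u ℤ.* t           ≡⟨ ut≡xs ⟩
      + x ℤ.* s           ≡⟨ cong (λ m → + m ℤ.* s) x≡ku ⟩
      + (k * u) ℤ.* s     ≡⟨ cong (ℤ._* s) (trans (ℤ.pos-* k u) (ℤ.*-comm (+ k) (+ u))) ⟩
      + u ℤ.* + k ℤ.* s   ≡⟨ ℤ.*-assoc (+ u) (+ k) s ⟩
      + u ℤ.* (+ k ℤ.* s) ∎)
      where open ≡-Reasoning

  near-cofactor : ∀ {K u s t} j p → Represents (+ u) s → t ≡ + (j * p) ℤ.* s →
                  ∣ t ∣ * (2 * K) ≤ ∣ n ∣ → Near (p * K) (j * u)
  near-cofactor {K} {u} {s} {t} j p rs t≡jps t≤ =
    + j ℤ.* s ,
    subst (λ y → Represents y (+ j ℤ.* s)) (sym (ℤ.pos-* j u)) (represents-* (+ j) rs) ,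
    subst (_≤ ∣ n ∣) bound≡ t≤
    where
    open ≡-Reasoning
    identity : ∀ j p S K → j * p * S * (2 * K) ≡ j * S * (2 * (p * K))
    identity j p S K = ℕ-Solver.solve (j ∷ p ∷ S ∷ K ∷ [])
    bound≡ : ∣ t ∣ * (2 * K) ≡ ∣ + j ℤ.* s ∣ * (2 * (p * K))
    bound≡ = begin
      ∣ t ∣ * (2 * K)               ≡⟨ cong (λ i → ∣ i ∣ * (2 * K)) t≡jps ⟩
      ∣ + (j * p) ℤ.* s ∣ * (2 * K) ≡⟨ cong (_* (2 * K)) (ℤ.abs-* (+ (j * p)) s) ⟩
      j * p * ∣ s ∣ * (2 * K)       ≡⟨ identity j p ∣ s ∣ K ⟩
      j * ∣ s ∣ * (2 * (p * K))     ≡⟨ cong (_* (2 * (p * K))) (ℤ.abs-* (+ j) s) ⟨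
      ∣ + j ℤ.* s ∣ * (2 * (p * K)) ∎

  least-near-characterisation : ∀ {K μ x} .{{_ : ℤ.NonZero n}} →
    0 < μ → Near K μ → (∀ y → 0 < y → y < μ → ¬ Near K y) → 0 < x → x < K → Near K x →
    (x ≢ μ) ⇔ (∃[ p ] (Prime p × ∃[ q ] (x ≡ q * p × Near (p * K) q)))
  least-near-characterisation {K} {μ} {x} 0<μ (s , rs , s≤) least 0<x x<K near-x@(t , rt , t≤) =
    mk⇔ prime-cofactor not-least
    where
    instance
      μ≢0 : NonZero μ
      μ≢0 = ℕ.>-nonZero 0<μ
    prime-cofactor : x ≢ μ → ∃[ p ] (Prime p × ∃[ q ] (x ≡ q * p × Near (p * K) q))
    prime-cofactor x≢μ = cofactor (∃-prime-divisor 1<k)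
      where
      μ<x : μ < x
      μ<x = ℕ.≤∧≢⇒< (ℕ.≮⇒≥ (λ x<μ → least x 0<x x<μ near-x)) (x≢μ ∘ sym)
      μ+x<2K : μ ℕ.+ x < 2 * K
      μ+x<2K = subst (μ ℕ.+ x <_) (cong (K ℕ.+_) (sym (ℕ.+-identityʳ K)))
                     (ℕ.+-mono-< (ℕ.<-trans μ<x x<K) x<K)
      k = x ℕ./ μ
      multiple : x ≡ k * μ × t ≡ + k ℤ.* s
      multiple = near-multiple-of-least {K} least rs s≤ rt t≤ μ+x<2K
      x≡kμ : x ≡ k * μ
      x≡kμ = proj₁ multiple
      t≡ks : t ≡ + k ℤ.* s
      t≡ks = proj₂ multiple
      1<k : 1 < k
      1<k = ℕ.*-cancelʳ-< μ 1 k (subst₂ _<_ (sym (ℕ.*-identityˡ μ)) x≡kμ μ<x)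
      cofactor : ∃[ p ] (Prime p × p ℕ.∣ k) →
                 ∃[ p ] (Prime p × ∃[ q ] (x ≡ q * p × Near (p * K) q))
      cofactor (p , p-prime , divides j k≡jp) =
        p , p-prime , j * μ , x≡jμp ,
        near-cofactor j p rs (subst (λ i → t ≡ + i ℤ.* s) k≡jp t≡ks) t≤
        where
        x≡jμp : x ≡ j * μ * p
        x≡jμp = trans x≡kμ (trans (cong (_* μ) k≡jp) (ℕ-Solver.solve (j ∷ p ∷ μ ∷ [])))
    not-least : ∃[ p ] (Prime p × ∃[ q ] (x ≡ q * p × Near (p * K) q)) → x ≢ μ
    not-least (p , p-prime , q , x≡qp , near-q) x≡μ =
      least q 0<q (subst (q <_) (trans (sym x≡qp) x≡μ) (ℕ.m<m*n q p 1<p))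
                  (near-antitone {K} {p * K} (ℕ.m≤n*m K p) near-q)
      where
      instance
        p≢0 : NonZero p
        p≢0 = prime⇒nonZero p-prime
        q≢0 : NonZero q
        q≢0 = ℕ.m*n≢0⇒m≢0 q {{subst NonZero x≡qp (ℕ.>-nonZero 0<x)}}
      1<p : 1 < p
      1<p = ℕ.nonTrivial⇒n>1 p {{prime⇒nonTrivial p-prime}}
      0<q : 0 < q
      0<q = ℕ.>-nonZero⁻¹ q

near⇔residue : ∀ N A K y .{{_ : NonZero N}} →
  Near (+ N) (+ A) K y ⇔ (A * y ℕ.% N * (2 * K) ≤ N ⊎ (N ∸ A * y ℕ.% N) * (2 * K) ≤ N)
near⇔residue N A K y = mk⇔
  (λ (t , rt , t≤) →
    Sum.map (λ r≤∣t∣ → ℕ.≤-trans (ℕ.*-monoˡ-≤ (2 * K) r≤∣t∣) t≤)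
            (λ N∸r≤∣t∣ → ℕ.≤-trans (ℕ.*-monoˡ-≤ (2 * K) N∸r≤∣t∣) t≤)
            (∣-⇒r≤∣t∣⊎N∸r≤∣t∣ {t = t} (represents-∣- (+ N) (+ A) rt represents-r) r≤N))
  [ (λ r≤ → + r , represents-r , r≤)
  , (λ N∸r≤ → + r ℤ.- + N , represents-r-N , subst (λ m → m * (2 * K) ≤ N) (sym ∣r-N∣≡N∸r) N∸r≤)
  ]′
  where
  r = A * y ℕ.% N
  r≤N : r ≤ N
  r≤N = ℕ.<⇒≤ (ℕ.m%n<n (A * y) N)
  represents-r : Represents (+ N) (+ A) (+ y) (+ r)
  represents-r = subst (Represents (+ N) (+ A) (+ y))
    (trans (cong (ℤ._- + (A * y ℕ./ N) ℤ.* + N) (sym (ℤ.pos-* A y)))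
           (+x-+[x/u]*+u≡+[x%u] (A * y) N))
    (represents-shift (+ N) (+ A) (+ (A * y ℕ./ N)) (represents-a*y (+ N) (+ A) (+ y)))
  represents-r-N : Represents (+ N) (+ A) (+ y) (+ r ℤ.- + N)
  represents-r-N = subst (λ i → Represents (+ N) (+ A) (+ y) (+ r ℤ.- i)) (ℤ.*-identityˡ (+ N))
    (represents-shift (+ N) (+ A) (+ 1) represents-r)
  ∣r-N∣≡N∸r : ∣ + r ℤ.- + N ∣ ≡ N ∸ r
  ∣r-N∣≡N∸r = trans (cong ∣_∣ (trans (ℤ.[+m]-[+n]≡m⊖n r N) (ℤ.⊖-≤ r≤N))) (ℤ.∣-i∣≡∣i∣ (+ (N ∸ r)))

‖h⁰‖≤1/2×⇔near : ∀ ℓ a K y .{{_ : NonZero K}} →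
                 (‖ h⁰ ℓ a y ‖ ≤ℚ 1/2× K) ⇔ Near (+ 2 ^ ℓ) (+ a) K y
‖h⁰‖≤1/2×⇔near ℓ a K y =
  ⇔-sym (near⇔residue (2 ^ ℓ) a K y) ⇔-∘
  ‖r/n‖≤1/2×⇔ (a * y ℕ.% 2 ^ ℓ) (2 ^ ℓ) K (ℕ.m%n<n (a * y) (2 ^ ℓ))
  where instance _ = ℕ.m^n≢0 2 ℓ

lemma7 : (ℓ ℓout : ℕ) → 1 ≤ ℓout → ℓout ≤ ℓ →
    (n a : ℕ) → n < 2 ^ ℓout → a < 2 ^ ℓ →
    (μ : ℕ) → IsMinMu ℓ (2 ^ ℓout) a μ →
    (x : ℕ) → 1 ≤ x → x < n →
    ‖ h⁰ ℓ a x ‖ ≤ℚ 1/2× (2 ^ ℓout) →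
    (x ≢ μ) ⇔ (∃[ p ] (Prime p × ∃[ q ] (x ≡ q * p × ‖ h⁰ ℓ a q ‖ ≤ℚ 1/2× (p * 2 ^ ℓout))))
lemma7 ℓ ℓout _ _ n a n<M _ μ (0<μ , μ-close , μ-least) x 0<x x<n x-close =
  cofactor-cong ⇔-∘ least-near-characterisation (+ 2 ^ ℓ) (+ a)
    0<μ (close⇒near μ-close) μ-least′ 0<x (ℕ.<-trans x<n n<M) (close⇒near x-close)
  where
  M = 2 ^ ℓout
  instance
    2^ℓ≢0 : NonZero (2 ^ ℓ)
    2^ℓ≢0 = ℕ.m^n≢0 2 ℓ
    M≢0 : NonZero M
    M≢0 = ℕ.m^n≢0 2 ℓout
  close⇒near : ∀ {y} → ‖ h⁰ ℓ a y ‖ ≤ℚ 1/2× M → Near (+ 2 ^ ℓ) (+ a) M y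
  close⇒near = Equivalence.to (‖h⁰‖≤1/2×⇔near ℓ a M _)
  μ-least′ : ∀ y → 0 < y → y < μ → ¬ Near (+ 2 ^ ℓ) (+ a) M y
  μ-least′ y 0<y y<μ near-y =
    μ-least y 0<y y<μ (Equivalence.from (‖h⁰‖≤1/2×⇔near ℓ a M y) near-y)
  cofactor-cong : (∃[ p ] (Prime p × ∃[ q ] (x ≡ q * p × Near (+ 2 ^ ℓ) (+ a) (p * M) q))) ⇔
                  (∃[ p ] (Prime p × ∃[ q ] (x ≡ q * p × ‖ h⁰ ℓ a q ‖ ≤ℚ 1/2× (p * M))))
  cofactor-cong = mk⇔
    (λ (p , p-prime , q , x≡qp , near-q) →
      p , p-prime , q , x≡qp , Equivalence.from (close⇔near p-prime q) near-q)
    (λ (p , p-prime , q , x≡qp , close-q) →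
      p , p-prime , q , x≡qp , Equivalence.to (close⇔near p-prime q) close-q)
    where
    close⇔near : ∀ {p} → Prime p → ∀ q →
                 (‖ h⁰ ℓ a q ‖ ≤ℚ 1/2× (p * M)) ⇔ Near (+ 2 ^ ℓ) (+ a) (p * M) q
    close⇔near {p} p-prime q =
      ‖h⁰‖≤1/2×⇔near ℓ a (p * M) q {{ℕ.m*n≢0 p M {{prime⇒nonZero p-prime}}}}
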